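{- Let $k \geq 3$, let $m_1,m_2 \in \mathbb{N}$, let $G = G_1+G_2$ where $G_i$ is a copy of $K_{1,m_i}$, with $G_1$ having bipartition $\{w_0\}$, $A$ and $G_2$ having bipartition $\{u_0\}$, $B$, and let $L$ be a $k$-assignment for $G$. Suppose the $\epsilon$-greedy process is run on $G$ and $L$, producing $G_\epsilon$, $L_\epsilon$, $g_\epsilon$. If some color appears in at least $\rho$ of the lists $L_\epsilon(v)$, $v \in V(G_\epsilon)-\{w_0,u_0\}$, where $\rho = \lceil |V(G)|/k\rceil$, then the range of $g_\epsilon$ has exactly $k-2$ elements.
   Context: A list assignment $L$ for a graph $G$ assigns to each vertex $v$ a set $L(v)$ of colors; it is a $k$-assignment if $|L(v)|=k$ for all $v$; its palette is $\mathcal{L}=\bigcup_{v} L(v)$. A partial $L$-coloring is a map $f$ defined on a subset $D\subseteq V(G)$ with $f(v)\in L(v)$ that is proper on $G[D]$. The $\epsilon$-greedy process (with $G,L,A,B,w_0,u_0,\rho$ as in the claim, $k\ge 3$): for $t = 1,2,\dots,k-2$ in turn, if there is a color $c_t \in \mathcal{L}-\{c_1,\dots,c_{t-1}\}$ lying in at least $\rho$ of the lists $L(v)$ with $v \in (A\cup B) - \bigcup_{i<t} C_i$, choose such a color $c_t$ and an arbitrary set $C_t$ of exactly $\rho$ such vertices, and continue; otherwise stop. If $s$ steps were completed ($0 \le s \le k-2$), the output is $G_\epsilon = G - \bigcup_{i=1}^s C_i$, the list assignment $L_\epsilon(v) = L(v) - \{c_1,\dots,c_s\}$ for $v \in V(G_\epsilon)$,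 and the partial $L$-coloring $g_\epsilon:\bigcup_{i=1}^s C_i \to \{c_1,\dots,c_s\}$ with $g_\epsilon(v)=c_i$ for $v\in C_i$. The claim holds for any run of the process (any choices made). -}

module Defs where

open import Data.Nat using (ℕ; zero; suc; _+_; _∸_; _≤_; _<_)
open import Data.Nat.DivMod using (_/_)
open import Data.Fin using (Fin)
open import Data.List using (List; []; _∷_; length; map)
open import Data.List.Membership.Propositional using (_∈_; _∉_)
open import Data.List.Relation.Unary.All using (All)
open import Data.List.Relation.Unary.Any using (Any)
open import Data.List.Relation.Unary.Unique.Propositional using (Unique)
open import Data.Product using (Σ; ∃; _×_; _,_; proj₁; proj₂)
open import Relation.Nullary using (¬_)
open import Relation.Binary.PropositionalEquality using (_≡_; _≢_)

-- Ceiling division ⌈ n / k ⌉ (k = 0 gives 0; irrelevant since k ≥ 3 below).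
⌈_/_⌉ : ℕ → ℕ → ℕ
⌈ n / zero ⌉ = zero
⌈ n / suc j ⌉ = (n + j) / suc j

-- Vertex set of G = G₁ + G₂ (disjoint union of the stars K_{1,m₁}, K_{1,m₂}):
-- centres w₀, u₀; leaves A = {a i}, B = {b j}.
data Vtx (m₁ m₂ : ℕ) : Set where
  w₀ : Vtx m₁ m₂
  u₀ : Vtx m₁ m₂
  a  : Fin m₁ → Vtx m₁ m₂
  b  : Fin m₂ → Vtx m₁ m₂

-- Edges of G (for reference; the process and claim do not use them).
data Adj {m₁ m₂ : ℕ} : Vtx m₁ m₂ → Vtx m₁ m₂ → Set where
  w₀a : ∀ i → Adj w₀ (a i)
  aw₀ : ∀ i → Adj (a i) w₀
  u₀b : ∀ j → Adj u₀ (b j)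
  bu₀ : ∀ j → Adj (b j) u₀

nV : ℕ → ℕ → ℕ
nV m₁ m₂ = m₁ + m₂ + 2

data InAB {m₁ m₂ : ℕ} : Vtx m₁ m₂ → Set where
  inA : ∀ i → InAB (a i)
  inB : ∀ j → InAB (b j)

-- Colors are natural numbers; a list assignment gives each vertex a list
-- of colors (a set is represented by a duplicate-free list).
ListAssignment : ℕ → ℕ → Set
ListAssignment m₁ m₂ = Vtx m₁ m₂ → List ℕ

IsKAssignment : {m₁ m₂ : ℕ} → ℕ → ListAssignment m₁ m₂ → Set
IsKAssignment k L = ∀ v → Unique (L v) × length (L v) ≡ k

InPalette : {m₁ m₂ : ℕ} → ListAssignment m₁ m₂ → ℕ → Set
InPalette {m₁} {m₂} L c = Σ (Vtx m₁ m₂) (λ v → c ∈ L v)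

AtLeast : {m₁ m₂ : ℕ} → ℕ → (Vtx m₁ m₂ → Set) → Set
AtLeast {m₁} {m₂} r P =
  Σ (List (Vtx m₁ m₂)) (λ S → Unique S × r ≤ length S × All P S)

-- A history of steps of the ε-greedy process, most recent step first:
-- each entry is (c_t , C_t).
Steps : ℕ → ℕ → Set
Steps m₁ m₂ = List (ℕ × List (Vtx m₁ m₂))

Removed : {m₁ m₂ : ℕ} → Steps m₁ m₂ → Vtx m₁ m₂ → Set
Removed st v = Any (λ p → v ∈ proj₂ p) st

UsedColor : {m₁ m₂ : ℕ} → Steps m₁ m₂ → ℕ → Set
UsedColor st c = c ∈ map proj₁ st

Avail : {m₁ m₂ : ℕ} → Steps m₁ m₂ → Vtx m₁ m₂ → Set
Avail st v = InAB v × ¬ Removed st v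

Eligible : {m₁ m₂ : ℕ} → ListAssignment m₁ m₂ → ℕ → Steps m₁ m₂ → ℕ → Set
Eligible L ρ st c =
  InPalette L c × ¬ UsedColor st c × AtLeast ρ (λ v → Avail st v × c ∈ L v)

data PartialRun {m₁ m₂ : ℕ} (L : ListAssignment m₁ m₂) (ρ : ℕ)
     : Steps m₁ m₂ → Set where
  done : PartialRun L ρ []
  step : ∀ {st} c C →
         PartialRun L ρ st →
         InPalette L c → ¬ UsedColor st c →
         AtLeast ρ (λ v → Avail st v × c ∈ L v) →
         Unique C → length C ≡ ρ →
         All (λ v → Avail st v × c ∈ L v) C →
         PartialRun L ρ ((c , C) ∷ st)

IsRun : {m₁ m₂ : ℕ} → ℕ → ListAssignment m₁ m₂ → ℕ → Steps m₁ m₂ → Set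
IsRun k L ρ st =
  PartialRun L ρ st × length st ≤ k ∸ 2 ×
  (length st < k ∸ 2 → ∀ c → ¬ Eligible L ρ st c)

InGε : {m₁ m₂ : ℕ} → Steps m₁ m₂ → Vtx m₁ m₂ → Set
InGε st v = ¬ Removed st v

InLε : {m₁ m₂ : ℕ} → ListAssignment m₁ m₂ → Steps m₁ m₂ → Vtx m₁ m₂ → ℕ → Set
InLε L st v c = c ∈ L v × ¬ UsedColor st c

Gε : {m₁ m₂ : ℕ} → Steps m₁ m₂ → Vtx m₁ m₂ → ℕ → Set
Gε st v c = Any (λ p → v ∈ proj₂ p × proj₁ p ≡ c) st

InRangeGε : {m₁ m₂ : ℕ} → Steps m₁ m₂ → ℕ → Set
InRangeGε {m₁} {m₂} st c = Σ (Vtx m₁ m₂) (λ v → Gε st v c)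

HasExactly : (ℕ → Set) → ℕ → Set
HasExactly P n =
  Σ (List ℕ) (λ R → Unique R × length R ≡ n × (∀ c → (c ∈ R → P c) × (P c → c ∈ R)))

module Submission where

-- The ε-greedy process stops early (after s < k−2 steps) only when
-- no colour is eligible, i.e. no unused colour lies in ρ of the lists of the
-- remaining leaves.  The hypothesis supplies a colour c lying in ρ lists
-- L_ε(v) of remaining vertices v ∉ {w₀, u₀}; such vertices are remaining
-- leaves, c ∈ L(v), and c is unused, so c is eligible at the end of the run.
-- Hence the run did not stop early and made exactly k−2 steps.  Since the
-- colours c_1, …, c_s chosen by a run are pairwise distinct and, as ρ ≥ 1,
-- every C_i is nonempty, the range of g_ε is exactly {c_1, …, c_s}, a set of
-- k−2 colours.

open import Defs
open import Data.Nat using (ℕ; suc; _+_; _≤_; _∸_; s≤s; z≤n)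
open import Data.Nat.Properties using (≤-trans; +-monoˡ-≤; m≤n+m; ≤∧≮⇒≡)
open import Data.Nat.DivMod using (m≥n⇒m/n>0)
open import Data.Product using (Σ; _×_; _,_; proj₁)
open import Data.List using ([]; _∷_; length; map)
open import Data.List.Properties using (length-map)
open import Data.List.Membership.Propositional using (_∈_)
open import Data.List.Relation.Unary.Any using (here; there)
open import Data.List.Relation.Unary.All as All using (All; _∷_)
open import Data.List.Relation.Unary.All.Properties using (¬Any⇒All¬)
open import Data.List.Relation.Unary.AllPairs using ([]; _∷_)
open import Data.List.Relation.Unary.Unique.Propositional using (Unique)
open import Data.Empty using (⊥-elim)
open import Relation.Binary.PropositionalEquality using (_≡_; _≢_; refl; trans)

⌈/⌉-positive : (n k : ℕ) → 1 ≤ n → 1 ≤ k → 1 ≤ ⌈ n / k ⌉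
⌈/⌉-positive n (suc j) 1≤n _ =
  m≥n⇒m/n>0 {n + j} {suc j} (+-monoˡ-≤ j 1≤n)

ρ-positive : (k m₁ m₂ : ℕ) → 3 ≤ k → 1 ≤ ⌈ nV m₁ m₂ / k ⌉
ρ-positive k m₁ m₂ 3≤k =
  ⌈/⌉-positive (nV m₁ m₂) k (≤-trans (s≤s z≤n) (m≤n+m 2 (m₁ + m₂))) (≤-trans (s≤s z≤n) 3≤k)

non-centre-leaf : ∀ {m₁ m₂} (v : Vtx m₁ m₂) → v ≢ w₀ → v ≢ u₀ → InAB v
non-centre-leaf w₀    v≢w₀ _    = ⊥-elim (v≢w₀ refl)
non-centre-leaf u₀    _    v≢u₀ = ⊥-elim (v≢u₀ refl)
non-centre-leaf (a i) _    _    = inA i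
non-centre-leaf (b j) _    _    = inB j

module _ {m₁ m₂ : ℕ} where

  AtLeast-map : ∀ {r} {P Q : Vtx m₁ m₂ → Set} →
                (∀ {v} → P v → Q v) → AtLeast r P → AtLeast r Q
  AtLeast-map P⇒Q (S , uniq , r≤|S| , allP) = S , uniq , r≤|S| , All.map P⇒Q allP

  AtLeast-witness : ∀ {r} {P : Vtx m₁ m₂ → Set} →
                    1 ≤ r → AtLeast r P → Σ (Vtx m₁ m₂) P
  AtLeast-witness _   (_ ∷ _ , _ , _ , pv ∷ _) = _ , pv
  AtLeast-witness 1≤r ([] , _ , r≤0 , _) with ≤-trans 1≤r r≤0
  ... | ()

module _ {m₁ m₂ : ℕ} {L : ListAssignment m₁ m₂} {ρ : ℕ} where

  -- Each step chooses a colour not used before, so c_1, …, c_s are distinct.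
  used-colours-unique : ∀ {st} → PartialRun L ρ st → Unique (map proj₁ st)
  used-colours-unique done = []
  used-colours-unique (step _ _ run _ unused _ _ _ _) =
    ¬Any⇒All¬ _ unused ∷ used-colours-unique run

  -- With ρ ≥ 1 every C_t is nonempty, so every used colour is a value of g_ε.
  used⇒range : ∀ {st c} → PartialRun L ρ st → 1 ≤ ρ →
               UsedColor st c → InRangeGε st c
  used⇒range (step _ [] _ _ _ _ _ refl _) () (here refl)
  used⇒range (step _ (v ∷ _) _ _ _ _ _ _ _) _ (here refl) = v , here (here refl , refl)
  used⇒range (step _ _ run _ _ _ _ _ _) 1≤ρ (there used) with used⇒range run 1≤ρ used
  ... | v , gv = v , there gv

range⇒used : ∀ {m₁ m₂} {st : Steps m₁ m₂} {c} → InRangeGε st c → UsedColor st c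
range⇒used (_ , here (_ , refl)) = here refl
range⇒used (v , there gv)        = there (range⇒used (v , gv))

module _ {m₁ m₂ : ℕ} {L : ListAssignment m₁ m₂} {ρ : ℕ} {st : Steps m₁ m₂} where

  final-colour-eligible : ∀ {c} → 1 ≤ ρ →
    AtLeast ρ (λ v → (InGε st v × v ≢ w₀ × v ≢ u₀) × InLε L st v c) →
    Eligible L ρ st c
  final-colour-eligible {c} 1≤ρ many with AtLeast-witness 1≤ρ many
  ... | v , _ , c∈Lv , unused = (v , c∈Lv) , unused , AtLeast-map available many
    where
    available : ∀ {u} → (InGε st u × u ≢ w₀ × u ≢ u₀) × InLε L st u c →
                Avail st u × c ∈ L u
    available {u} ((kept , u≢w₀ , u≢u₀) , c∈Lu , _) =
      (non-centre-leaf u u≢w₀ u≢u₀ , kept) , c∈Lu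

  eligible⇒complete : ∀ k {c} → IsRun k L ρ st → Eligible L ρ st c →
                      length st ≡ k ∸ 2
  eligible⇒complete k {c} (_ , s≤k∸2 , stopped) elig =
    ≤∧≮⇒≡ s≤k∸2 (λ s<k∸2 → stopped s<k∸2 c elig)

lemma4p4 : (k m₁ m₂ : ℕ) → 3 ≤ k →
    (L : ListAssignment m₁ m₂) → IsKAssignment k L →
    (st : Steps m₁ m₂) → IsRun k L ⌈ nV m₁ m₂ / k ⌉ st →
    Σ ℕ (λ c → AtLeast ⌈ nV m₁ m₂ / k ⌉
                 (λ v → (InGε st v × v ≢ w₀ × v ≢ u₀) × InLε L st v c)) →
    HasExactly (InRangeGε st) (k ∸ 2)
lemma4p4 k m₁ m₂ 3≤k L _ st run (c , many) =
  map proj₁ st ,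
  used-colours-unique (proj₁ run) ,
  trans (length-map proj₁ st) complete ,
  λ _ → used⇒range (proj₁ run) 1≤ρ , range⇒used
  where
  1≤ρ : 1 ≤ ⌈ nV m₁ m₂ / k ⌉
  1≤ρ = ρ-positive k m₁ m₂ 3≤k

  complete : length st ≡ k ∸ 2
  complete = eligible⇒complete k run (final-colour-eligible 1≤ρ many)
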